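{- Let $(G,*)$ be a groupoid satisfying the identities (i) $(xy)z\approx(xz)y$, (ii) $w(x(yz))\approx w((xy)z)$, (iii) $(wx)(yz)\approx(wy)(xz)$. Then $s_n(*)\le 2^{n-2}$ and $s^{ac}_n(*)\le n(2^{n-1}-1)$ for $n=2,3,\dots$, and the first upper bound is reached whenever the second one is. Moreover, both upper bounds are reached for the 3-element groupoids $\mathrm{SC}271$ (rows $0{:}\ 0\,0\,0$; $1{:}\ 1\,1\,0$; $2{:}\ 2\,2\,2$), $\mathrm{SC}356$ (rows $0{:}\ 0\,0\,0$; $1{:}\ 2\,1\,1$; $2{:}\ 1\,2\,2$), $\mathrm{SC}1610$ (rows $0{:}\ 0\,1\,1$; $1{:}\ 0\,1\,2$; $2{:}\ 0\,1\,2$), and $\mathrm{SC}2032$ (rows $0{:}\ 0\,1\,2$; $1{:}\ 0\,1\,2$; $2{:}\ 1\,0\,2$).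
   Context: A groupoid $(G,*)$ is a set with a binary operation; $xy$ denotes $x*y$. $\mathcal B_n$ is the set of bracketings of the word $x_1x_2\cdots x_n$ (all ways to insert parentheses), and $\mathcal F_n$ is the set of full linear terms, obtained from bracketings by permuting the variables. Each such term $t$ induces an $n$-ary operation $t^*$ on $G$. The associative spectrum is $s_n(*):=|\{t^*:t\in\mathcal B_n\}|$ and the associative-commutative spectrum is $s^{ac}_n(*):=|\{t^*:t\in\mathcal F_n\}|$. A groupoid satisfies an identity if both sides take equal values under every assignment of elements of $G$ to the variables. A 3-element groupoid on $\{0,1,2\}$ is given by its Cayley table; "row $a{:}\ p\,q\,r$" means $a*0=p$, $a*1=q$, $a*2=r$. -}

module Defs where

open import Data.Nat using (ℕ; _≤_)
open import Data.Fin using (Fin; zero; suc)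
open import Data.List using (List; []; _∷_; _++_; allFin; [_])
open import Data.List.Relation.Binary.Permutation.Propositional using (_↭_)
open import Data.Product using (Σ; ∃; _×_; _,_)
open import Relation.Binary.PropositionalEquality using (_≡_)

data Term (n : ℕ) : Set where
  var : Fin n → Term n
  _·_ : Term n → Term n → Term n

leaves : ∀ {n} → Term n → List (Fin n)
leaves (var i) = [ i ]
leaves (t · u) = leaves t ++ leaves u

IsBracketing : ∀ {n} → Term n → Set
IsBracketing {n} t = leaves t ≡ allFin n

IsFullLinear : ∀ {n} → Term n → Set
IsFullLinear {n} t = leaves t ↭ allFin n

eval : ∀ {G : Set} {n} → (G → G → G) → Term n → (Fin n → G) → G
eval _*_ (var i) ρ = ρ i
eval _*_ (t · u) ρ = eval _*_ t ρ * eval _*_ u ρ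

SameOp : ∀ {G : Set} {n} → (G → G → G) → Term n → Term n → Set
SameOp {G} {n} _*_ t u = ∀ (ρ : Fin n → G) → eval _*_ t ρ ≡ eval _*_ u ρ

-- |{t^* : P t}| ≤ k : at most k operations cover all induced operations
AtMost : ∀ {G : Set} → (G → G → G) → (n : ℕ) → (Term n → Set) → ℕ → Set
AtMost _*_ n P k =
  Σ ℕ λ k' → k' ≤ k × Σ (Fin k' → Term n) λ f →
    (∀ i → P (f i)) × (∀ t → P t → ∃ λ i → SameOp _*_ (f i) t)

-- |{t^* : P t}| ≥ k : k terms in P inducing pairwise distinct operations
AtLeast : ∀ {G : Set} → (G → G → G) → (n : ℕ) → (Term n → Set) → ℕ → Set
AtLeast _*_ n P k =
  Σ (Fin k → Term n) λ f →
    (∀ i → P (f i)) × (∀ i j → SameOp _*_ (f i) (f j) → i ≡ j)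

sLe sGe sEq : ∀ {G : Set} → (G → G → G) → ℕ → ℕ → Set
sLe _*_ n k = AtMost _*_ n IsBracketing k
sGe _*_ n k = AtLeast _*_ n IsBracketing k
sEq _*_ n k = sLe _*_ n k × sGe _*_ n k

sacLe sacGe sacEq : ∀ {G : Set} → (G → G → G) → ℕ → ℕ → Set
sacLe _*_ n k = AtMost _*_ n IsFullLinear k
sacGe _*_ n k = AtLeast _*_ n IsFullLinear k
sacEq _*_ n k = sacLe _*_ n k × sacGe _*_ n k

Identities : ∀ {G : Set} → (G → G → G) → Set
Identities {G} _*_ =
  (∀ x y z → (x * y) * z ≡ (x * z) * y) ×
  (∀ w x y z → w * (x * (y * z)) ≡ w * ((x * y) * z)) ×
  (∀ w x y z → (w * x) * (y * z) ≡ (w * y) * (x * z))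

-- Three-element groupoids on {0,1,2} = Fin 3;  a ∘ b = row a, column b
pattern 𝟘 = zero
pattern 𝟙 = suc zero
pattern 𝟚 = suc (suc zero)

SC271 : Fin 3 → Fin 3 → Fin 3
SC271 𝟘 _ = 𝟘
SC271 𝟙 𝟘 = 𝟙
SC271 𝟙 𝟙 = 𝟙
SC271 𝟙 𝟚 = 𝟘
SC271 𝟚 _ = 𝟚

SC356 : Fin 3 → Fin 3 → Fin 3
SC356 𝟘 _ = 𝟘
SC356 𝟙 𝟘 = 𝟚
SC356 𝟙 𝟙 = 𝟙
SC356 𝟙 𝟚 = 𝟙
SC356 𝟚 𝟘 = 𝟙
SC356 𝟚 𝟙 = 𝟚
SC356 𝟚 𝟚 = 𝟚

SC1610 : Fin 3 → Fin 3 → Fin 3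
SC1610 𝟘 𝟘 = 𝟘
SC1610 𝟘 𝟙 = 𝟙
SC1610 𝟘 𝟚 = 𝟙
SC1610 𝟙 b = b
SC1610 𝟚 b = b

SC2032 : Fin 3 → Fin 3 → Fin 3
SC2032 𝟘 b = b
SC2032 𝟙 b = b
SC2032 𝟚 𝟘 = 𝟙
SC2032 𝟚 𝟙 = 𝟘
SC2032 𝟚 𝟚 = 𝟚

-- Under (i)–(iii) the value of a term depends only on its leftmost variable a, the multiset
-- D = {b₁, …, bₘ} of variables of right depth one and the multiset C = {c₁, …, cₖ} of the deeper
-- ones: the term equals (⋯((a · (⋯(b₁ · c₁)⋯ · cₖ)) · b₂)⋯) · bₘ. Identity (i) permutes the
-- arguments of a left comb, (ii) flattens an argument into its leaves under a left factor, and
-- (iii) lets the tails of all arguments migrate into the first one. For a full linear term D ≠ ∅,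
-- so there are at most n(2ⁿ⁻¹ − 1) choices of (a, D, C); a bracketing has a = x₁ and x₂ ∈ D, and
-- D determines C, so at most 2ⁿ⁻² operations arise. If the n(2ⁿ⁻¹ − 1) normal forms induce
-- distinct operations, then bracketings with distinct D do too, which gives the third claim.
-- For SC271, SC356 and the opposites of SC1610, SC2032 there are α, β such that evaluating at
-- β on one variable z and α elsewhere returns β, αβ or α according as z is a, in D, or in C;
-- this separates any two normal forms.

module Submission where

open import Defs
open import Data.Empty using (⊥; ⊥-elim)
open import Data.Fin using (Fin; zero; suc; opposite; inject₁; fromℕ; punchOut)
open import Data.Fin.Properties using (_≟_; all?; any?; pigeonhole; punchOut-injective; <⇒≢; opposite-involutive)
open import Data.List
  using (List; []; _∷_; _++_; [_]; _∷ʳ_; map; concatMap; foldl; length; lookup; allFin; tabulate; reverse)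
open import Data.List.Properties
  using (++-assoc; ++-identityʳ; map-++; map-∘; map-id; map-cong; map-tabulate; concatMap-++; foldl-++; foldl-∷ʳ;
         length-++; length-map; length-tabulate; reverse-++; reverse-map; ∷-injectiveˡ; ∷-injectiveʳ)
open import Data.List.NonEmpty using (List⁺; toList) renaming (_∷_ to _∷⁺_)
open import Data.List.Membership.Propositional using (_∈_; _∉_)
open import Data.List.Membership.Propositional.Properties
  using (∈-∃++; ∈-++⁻; ∈-++⁺ˡ; ∈-++⁺ʳ; ∈-map⁺; ∈-lookup; ∈-concatMap⁺)
open import Data.List.Relation.Binary.Subset.Propositional using (_⊆_)
open import Data.List.Relation.Binary.Permutation.Propositional
  using (_↭_; prep; swap; ↭-refl; ↭-sym; ↭-trans; ↭-reflexive; ↭⇒↭ₛ)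
open import Data.List.Relation.Binary.Permutation.Propositional.Properties
  using (++⁺ˡ; ++⁺ʳ; shift; shifts; drop-∷; map⁺; ∈-resp-↭; ↭-empty-inv; ↭-length; ↭-reverse; ∷↭∷ʳ)
  renaming (++-comm to ++-comm-↭)
import Data.List.Relation.Binary.Permutation.Setoid.Properties as PermutationSetoid
open import Data.List.Relation.Unary.All as All using (All; []; _∷_)
import Data.List.Relation.Unary.All.Properties as All
open import Data.List.Relation.Unary.AllPairs as AllPairs using (AllPairs; []; _∷_)
import Data.List.Relation.Unary.AllPairs.Properties as AllPairs
open import Data.List.Relation.Unary.Any as Any using (here; there)
open import Data.List.Relation.Unary.Any.Properties using (lookup-index)
open import Data.List.Relation.Unary.Unique.Propositional using (Unique)
open import Data.List.Relation.Unary.Unique.Propositional.Properties using (allFin⁺)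
open import Data.Nat using (ℕ; zero; suc; _≤_; _*_; _∸_; _^_; _+_; z≤n; s≤s)
open import Data.Nat.Properties using (+-identityʳ; +-suc; ≤-reflexive; n<1+n)
open import Data.Product using (∃; ∃₂; _×_; _,_; proj₁; proj₂; map₁; map₂)
open import Data.Sum using (_⊎_; inj₁; inj₂)
open import Function using (_∘_; id; flip; _on_)
open import Relation.Nullary using (¬_; yes; no)
open import Relation.Nullary.Decidable using (Dec; from-yes; map′; ¬?; _×-dec_; _→-dec_)
open import Relation.Binary.Definitions using (Symmetric)
open import Relation.Binary.PropositionalEquality
  using (_≡_; _≢_; refl; sym; trans; cong; cong₂; subst; subst₂; setoid; module ≡-Reasoning)

private variable
  A B : Set
  n : ℕ

∈⇒↭∷ : {x : A} {ys : List A} → x ∈ ys → ∃ λ zs → ys ↭ x ∷ zs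
∈⇒↭∷ {x = x} x∈ys with l , r , refl ← ∈-∃++ x∈ys = l ++ r , shift x l r

++-cancelˡ-↭ : ∀ (xs : List A) {ys zs} → xs ++ ys ↭ xs ++ zs → ys ↭ zs
++-cancelˡ-↭ [] p = p
++-cancelˡ-↭ (x ∷ xs) p = ++-cancelˡ-↭ xs (drop-∷ p)

Unique-resp-↭ : {xs ys : List A} → xs ↭ ys → Unique xs → Unique ys
Unique-resp-↭ {A = A} p = PermutationSetoid.Unique-resp-↭ (setoid A) (↭⇒↭ₛ p)

Unique-++⇒disjoint : ∀ (xs : List A) {ys z} → Unique (xs ++ ys) → z ∈ xs → z ∈ ys → ⊥
Unique-++⇒disjoint (x ∷ xs) (x∉ ∷ _) (here refl) z∈ys = All.lookup x∉ (∈-++⁺ʳ xs z∈ys) refl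
Unique-++⇒disjoint (x ∷ xs) (_ ∷ u) (there z∈xs) z∈ys = Unique-++⇒disjoint xs u z∈xs z∈ys

Unique-++⁻ˡ : ∀ (xs : List A) {ys} → Unique (xs ++ ys) → Unique xs
Unique-++⁻ˡ [] _ = []
Unique-++⁻ˡ (x ∷ xs) (x∉ ∷ u) = All.++⁻ˡ xs x∉ ∷ Unique-++⁻ˡ xs u

AllPairs-mapWith : ∀ {P : A → Set} {R S : A → A → Set} {xs} →
  (∀ {x y} → P x → P y → R x y → S x y) → All P xs → AllPairs R xs → AllPairs S xs
AllPairs-mapWith f [] [] = []
AllPairs-mapWith f (px ∷ pxs) (rx ∷ rxs) =
  All.zipWith (λ (py , r) → f px py r) (pxs , rx) ∷ AllPairs-mapWith f pxs rxs

lookup-injective : {R : A → A → Set} {xs : List A} → Symmetric R → AllPairs (λ x y → ¬ R x y) xs →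
  ∀ i j → R (lookup xs i) (lookup xs j) → i ≡ j
lookup-injective sym-R (_ ∷ _) zero zero _ = refl
lookup-injective sym-R (¬R ∷ _) zero (suc j) r = ⊥-elim (All.lookup ¬R (∈-lookup j) r)
lookup-injective sym-R (¬R ∷ _) (suc i) zero r = ⊥-elim (All.lookup ¬R (∈-lookup i) (sym-R r))
lookup-injective sym-R (_ ∷ ps) (suc i) (suc j) r = cong suc (lookup-injective sym-R ps i j r)

All-All-map : ∀ {C : Set} {R : C → C → Set} (f : A → C) (g : B → C) → (∀ a b → R (f a) (g b)) →
  ∀ xs ys → All (λ u → All (R u) (map g ys)) (map f xs)
All-All-map f g R-fg xs ys = All.map⁺ (All.universal (λ a → All.map⁺ (All.universal (R-fg a) ys)) xs)

length-concatMap : ∀ (f : A → List B) k {xs} → All (λ x → length (f x) ≡ k) xs →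
  length (concatMap f xs) ≡ length xs * k
length-concatMap f k [] = refl
length-concatMap f k {x ∷ xs} (p ∷ ps) = trans (length-++ (f x)) (cong₂ _+_ p (length-concatMap f k ps))

selections : List A → List (A × List A)
selections [] = []
selections (x ∷ xs) = (x , xs) ∷ map (map₂ (x ∷_)) (selections xs)

selections-↭ : ∀ (xs : List A) → All (λ (y , ys) → y ∷ ys ↭ xs) (selections xs)
selections-↭ [] = []
selections-↭ (x ∷ xs) =
  ↭-refl ∷ All.map⁺ (All.map (λ {(y , ys)} p → ↭-trans (swap y x ↭-refl) (prep x p)) (selections-↭ xs))

length-selections : ∀ (xs : List A) → length (selections xs) ≡ length xs
length-selections [] = refl
length-selections (x ∷ xs) = cong suc (trans (length-map _ (selections xs)) (length-selections xs))

selections-cover : ∀ (xs : List A) {a R} → a ∷ R ↭ xs → ∃ λ r → (a , r) ∈ selections xs × r ↭ R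
selections-cover [] p with () ← ↭-empty-inv p
selections-cover (x ∷ xs) {a} {R} p with ∈-resp-↭ p (here refl)
... | here refl = xs , here refl , ↭-sym (drop-∷ p)
... | there a∈xs with zs , xs↭ ← ∈⇒↭∷ a∈xs with r , r∈ , r↭ ← selections-cover xs (↭-sym xs↭) =
  x ∷ r , there (∈-map⁺ _ r∈) , ↭-sym R↭
  where
    R↭ : R ↭ x ∷ r
    R↭ = drop-∷ (↭-trans p (↭-trans (prep x xs↭) (↭-trans (swap x a ↭-refl) (prep a (prep x (↭-sym r↭))))))

selections-distinct : ∀ {xs : List A} → Unique xs → AllPairs (λ p q → proj₁ p ≢ proj₁ q) (selections xs)
selections-distinct {xs = []} _ = []
selections-distinct {xs = x ∷ xs} (x∉ ∷ u) =
  All.map⁺ (All.map (λ {(y , ys)} p → All.lookup x∉ (∈-resp-↭ p (here refl))) (selections-↭ xs))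
  ∷ AllPairs.map⁺ (selections-distinct u)

bipartitions : List A → List (List A × List A)
bipartitions [] = [ [] , [] ]
bipartitions (x ∷ xs) = map (map₁ (x ∷_)) (bipartitions xs) ++ map (map₂ (x ∷_)) (bipartitions xs)

bipartitions⁺ : List A → List (List⁺ A × List A)
bipartitions⁺ [] = []
bipartitions⁺ (x ∷ xs) = map (map₁ (x ∷⁺_)) (bipartitions xs) ++ map (map₂ (x ∷_)) (bipartitions⁺ xs)

bipartitions-↭ : ∀ (xs : List A) → All (λ (s , c) → s ++ c ↭ xs) (bipartitions xs)
bipartitions-↭ [] = ↭-refl ∷ []
bipartitions-↭ (x ∷ xs) = All.++⁺
  (All.map⁺ (All.map (prep x) (bipartitions-↭ xs)))
  (All.map⁺ (All.map (λ {(s , c)} p → ↭-trans (shift x s c) (prep x p)) (bipartitions-↭ xs)))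

bipartitions⁺-↭ : ∀ (xs : List A) → All (λ (s , c) → toList s ++ c ↭ xs) (bipartitions⁺ xs)
bipartitions⁺-↭ [] = []
bipartitions⁺-↭ (x ∷ xs) = All.++⁺
  (All.map⁺ (All.map (prep x) (bipartitions-↭ xs)))
  (All.map⁺ (All.map (λ {(s , c)} p → ↭-trans (shift x (toList s) c) (prep x p)) (bipartitions⁺-↭ xs)))

length-map-++-map : ∀ {C : Set} (f : A → C) (g : B → C) xs ys →
  length (map f xs ++ map g ys) ≡ length xs + length ys
length-map-++-map f g xs ys = trans (length-++ (map f xs)) (cong₂ _+_ (length-map f xs) (length-map g ys))

length-bipartitions : ∀ (xs : List A) → length (bipartitions xs) ≡ 2 ^ length xs
length-bipartitions [] = refl
length-bipartitions (x ∷ xs) = begin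
  length (map (map₁ (x ∷_)) P ++ map (map₂ (x ∷_)) P) ≡⟨ length-map-++-map _ _ P P ⟩
  length P + length P
    ≡⟨ cong₂ _+_ (length-bipartitions xs) (trans (length-bipartitions xs) (sym (+-identityʳ (2 ^ length xs)))) ⟩
  2 ^ length xs + (2 ^ length xs + 0) ∎
  where
    open ≡-Reasoning
    P = bipartitions xs

suc-length-bipartitions⁺ : ∀ (xs : List A) → suc (length (bipartitions⁺ xs)) ≡ 2 ^ length xs
suc-length-bipartitions⁺ [] = refl
suc-length-bipartitions⁺ (x ∷ xs) = begin
  suc (length (map (map₁ (x ∷⁺_)) P ++ map (map₂ (x ∷_)) P⁺)) ≡⟨ cong suc (length-map-++-map _ _ P P⁺) ⟩
  suc (length P + length P⁺)                                  ≡⟨ +-suc (length P) (length P⁺) ⟨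
  length P + suc (length P⁺)
    ≡⟨ cong₂ _+_ (length-bipartitions xs) (trans (suc-length-bipartitions⁺ xs) (sym (+-identityʳ (2 ^ length xs)))) ⟩
  2 ^ length xs + (2 ^ length xs + 0) ∎
  where
    open ≡-Reasoning
    P = bipartitions xs
    P⁺ = bipartitions⁺ xs

split-head : ∀ {x : A} {xs} s c → s ++ c ↭ x ∷ xs →
  (∃ λ s′ → s ↭ x ∷ s′ × s′ ++ c ↭ xs) ⊎ (∃ λ c′ → c ↭ x ∷ c′ × s ++ c′ ↭ xs)
split-head {x = x} s c p with ∈-++⁻ s (∈-resp-↭ (↭-sym p) (here refl))
... | inj₁ x∈s with s′ , s↭ ← ∈⇒↭∷ x∈s = inj₁ (s′ , s↭ , drop-∷ (↭-trans (↭-sym (++⁺ʳ c s↭)) p))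
... | inj₂ x∈c with c′ , c↭ ← ∈⇒↭∷ x∈c =
  inj₂ (c′ , c↭ , drop-∷ (↭-trans (↭-sym (↭-trans (++⁺ˡ s c↭) (shift x s c′))) p))

bipartitions-cover : ∀ (xs : List A) s c → s ++ c ↭ xs →
  ∃₂ λ s′ c′ → (s′ , c′) ∈ bipartitions xs × s′ ↭ s × c′ ↭ c
bipartitions-cover [] [] [] _ = [] , [] , here refl , ↭-refl , ↭-refl
bipartitions-cover [] (_ ∷ _) _ p with () ← ↭-empty-inv p
bipartitions-cover [] [] (_ ∷ _) p with () ← ↭-empty-inv p
bipartitions-cover (x ∷ xs) s c p with split-head s c p
... | inj₁ (s′ , s↭ , p′) with s₀ , c₀ , ∈B , s₀↭ , c₀↭ ← bipartitions-cover xs s′ c p′ =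
  _ , _ , ∈-++⁺ˡ (∈-map⁺ _ ∈B) , ↭-trans (prep x s₀↭) (↭-sym s↭) , c₀↭
... | inj₂ (c′ , c↭ , p′) with s₀ , c₀ , ∈B , s₀↭ , c₀↭ ← bipartitions-cover xs s c′ p′ =
  _ , _ , ∈-++⁺ʳ _ (∈-map⁺ _ ∈B) , s₀↭ , ↭-trans (prep x c₀↭) (↭-sym c↭)

bipartitions⁺-cover : ∀ (xs : List A) b bs c → b ∷ bs ++ c ↭ xs →
  ∃₂ λ s′ c′ → (s′ , c′) ∈ bipartitions⁺ xs × toList s′ ↭ b ∷ bs × c′ ↭ c
bipartitions⁺-cover [] b bs c p with () ← ↭-empty-inv p
bipartitions⁺-cover (x ∷ xs) b bs c p with split-head (b ∷ bs) c p
... | inj₁ (s′ , s↭ , p′) with s₀ , c₀ , ∈B , s₀↭ , c₀↭ ← bipartitions-cover xs s′ c p′ =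
  _ , _ , ∈-++⁺ˡ (∈-map⁺ _ ∈B) , ↭-trans (prep x s₀↭) (↭-sym s↭) , c₀↭
... | inj₂ (c′ , c↭ , p′) with s₀ , c₀ , ∈B , s₀↭ , c₀↭ ← bipartitions⁺-cover xs b bs c′ p′ =
  _ , _ , ∈-++⁺ʳ _ (∈-map⁺ _ ∈B) , s₀↭ , ↭-trans (prep x c₀↭) (↭-sym c↭)

Separated : List A × List A → List A × List A → Set
Separated (s , c) (s′ , c′) = (∃ λ z → z ∈ s × z ∈ c′) ⊎ (∃ λ z → z ∈ s′ × z ∈ c)

separated-∷ˡ : ∀ x {p q : List A × List A} → Separated p q → Separated (map₁ (x ∷_) p) (map₁ (x ∷_) q)
separated-∷ˡ x (inj₁ (z , z∈s , z∈c′)) = inj₁ (z , there z∈s , z∈c′)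
separated-∷ˡ x (inj₂ (z , z∈s′ , z∈c)) = inj₂ (z , there z∈s′ , z∈c)

separated-∷ʳ : ∀ x {p q : List A × List A} → Separated p q → Separated (map₂ (x ∷_) p) (map₂ (x ∷_) q)
separated-∷ʳ x (inj₁ (z , z∈s , z∈c′)) = inj₁ (z , z∈s , there z∈c′)
separated-∷ʳ x (inj₂ (z , z∈s′ , z∈c)) = inj₂ (z , z∈s′ , there z∈c)

bipartitions-separated : ∀ (xs : List A) → AllPairs Separated (bipartitions xs)
bipartitions-separated [] = [] ∷ []
bipartitions-separated (x ∷ xs) = AllPairs.++⁺
  (AllPairs.map⁺ (AllPairs.map (separated-∷ˡ x) (bipartitions-separated xs)))
  (AllPairs.map⁺ (AllPairs.map (separated-∷ʳ x) (bipartitions-separated xs)))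
  (All-All-map _ _ (λ _ _ → inj₁ (x , here refl , here refl)) (bipartitions xs) (bipartitions xs))

bipartitions⁺-separated : ∀ (xs : List A) →
  AllPairs (Separated on map₁ toList) (bipartitions⁺ xs)
bipartitions⁺-separated [] = []
bipartitions⁺-separated (x ∷ xs) = AllPairs.++⁺
  (AllPairs.map⁺ {f = map₁ (x ∷⁺_)} (AllPairs.map (separated-∷ˡ x) (bipartitions-separated xs)))
  (AllPairs.map⁺ (AllPairs.map (λ {p} {q} → separated-∷ʳ x {map₁ toList p} {map₁ toList q})
    (bipartitions⁺-separated xs)))
  (All-All-map (map₁ (x ∷⁺_)) (map₂ (x ∷_)) (λ _ _ → inj₁ (x , here refl , here refl))
    (bipartitions xs) (bipartitions⁺ xs))

leftmost : Term n → Fin n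
leftmost (var i) = i
leftmost (t · u) = leftmost t

tailLeaves : Term n → List (Fin n)
tailLeaves (var i) = []
tailLeaves (t · u) = tailLeaves t ++ leaves u

-- t = (⋯((var (leftmost t) · u₁) · u₂) ⋯) · uₖ  where  arguments t = u₁ ∷ ⋯ ∷ uₖ
arguments : Term n → List (Term n)
arguments (var i) = []
arguments (t · u) = arguments t ++ [ u ]

-- The variables of right depth one, resp. at least two: those reached from the root
-- through exactly one, resp. at least two, right branches.
depth1 : Term n → List (Fin n)
depth1 t = map leftmost (arguments t)

depth≥2 : Term n → List (Fin n)
depth≥2 t = concatMap tailLeaves (arguments t)

record SameDepths (t u : Term n) : Set where
  constructor sameDepths
  field
    leftmost≡ : leftmost t ≡ leftmost u
    depth1↭ : depth1 t ↭ depth1 u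
    depth≥2↭ : depth≥2 t ↭ depth≥2 u

applyAll : Term n → List (Term n) → Term n
applyAll t [] = t
applyAll t (u ∷ us) = applyAll (t · u) us

leaves-leftmost : (t : Term n) → leaves t ≡ leftmost t ∷ tailLeaves t
leaves-leftmost (var i) = refl
leaves-leftmost (t · u) = cong (_++ leaves u) (leaves-leftmost t)

leaves-arguments : (t : Term n) → leaves t ≡ leftmost t ∷ concatMap leaves (arguments t)
leaves-arguments (var i) = refl
leaves-arguments (t · u) = begin
  leaves t ++ leaves u
    ≡⟨ cong (_++ leaves u) (leaves-arguments t) ⟩
  leftmost t ∷ concatMap leaves (arguments t) ++ leaves u
    ≡⟨ cong (λ l → leftmost t ∷ concatMap leaves (arguments t) ++ l) (sym (++-identityʳ (leaves u))) ⟩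
  leftmost t ∷ concatMap leaves (arguments t) ++ concatMap leaves [ u ]
    ≡⟨ cong (leftmost t ∷_) (sym (concatMap-++ leaves (arguments t) [ u ])) ⟩
  leftmost t ∷ concatMap leaves (arguments t ++ [ u ]) ∎
  where open ≡-Reasoning

concatMap-leaves-↭ : (us : List (Term n)) →
  concatMap leaves us ↭ map leftmost us ++ concatMap tailLeaves us
concatMap-leaves-↭ [] = ↭-refl
concatMap-leaves-↭ (u ∷ us) rewrite leaves-leftmost u =
  prep (leftmost u) (↭-trans (++⁺ˡ (tailLeaves u) (concatMap-leaves-↭ us))
                             (shifts (tailLeaves u) (map leftmost us)))

leaves-↭-depths : (t : Term n) → leaves t ↭ leftmost t ∷ depth1 t ++ depth≥2 t
leaves-↭-depths t rewrite leaves-arguments t = prep (leftmost t) (concatMap-leaves-↭ (arguments t))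

depth1-· : (t u : Term n) → depth1 (t · u) ≡ depth1 t ++ [ leftmost u ]
depth1-· t u = map-++ leftmost (arguments t) [ u ]

depth≥2-· : (t u : Term n) → depth≥2 (t · u) ≡ depth≥2 t ++ tailLeaves u
depth≥2-· t u = trans (concatMap-++ tailLeaves (arguments t) [ u ])
                      (cong (depth≥2 t ++_) (++-identityʳ (tailLeaves u)))

depth≥2-empty : (us : List (Term n)) → map leftmost us ≡ [] → concatMap tailLeaves us ≡ []
depth≥2-empty [] _ = refl

arguments-applyAll : (t : Term n) (us : List (Term n)) → arguments (applyAll t us) ≡ arguments t ++ us
arguments-applyAll t [] = sym (++-identityʳ (arguments t))
arguments-applyAll t (u ∷ us) = trans (arguments-applyAll (t · u) us) (++-assoc (arguments t) [ u ] us)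

leftmost-applyAll : (t : Term n) (us : List (Term n)) → leftmost (applyAll t us) ≡ leftmost t
leftmost-applyAll t [] = refl
leftmost-applyAll t (u ∷ us) = leftmost-applyAll (t · u) us

leaves-applyAll : (t : Term n) (us : List (Term n)) → leaves (applyAll t us) ≡ leaves t ++ concatMap leaves us
leaves-applyAll t [] = sym (++-identityʳ (leaves t))
leaves-applyAll t (u ∷ us) =
  trans (leaves-applyAll (t · u) us) (++-assoc (leaves t) (leaves u) (concatMap leaves us))

tailLeaves-applyAll : (t : Term n) (us : List (Term n)) →
  tailLeaves (applyAll t us) ≡ tailLeaves t ++ concatMap leaves us
tailLeaves-applyAll t [] = sym (++-identityʳ (tailLeaves t))
tailLeaves-applyAll t (u ∷ us) =
  trans (tailLeaves-applyAll (t · u) us) (++-assoc (tailLeaves t) (leaves u) (concatMap leaves us))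

eval-applyAll : ∀ {G : Set} (_∙_ : G → G → G) (t : Term n) us ρ →
  eval _∙_ (applyAll t us) ρ ≡ foldl _∙_ (eval _∙_ t ρ) (map (λ u → eval _∙_ u ρ) us)
eval-applyAll _∙_ t [] ρ = refl
eval-applyAll _∙_ t (u ∷ us) ρ = eval-applyAll _∙_ (t · u) us ρ

module NormalForm {G : Set} (_∙_ : G → G → G) (identities : Identities _∙_) where

  right-comm : ∀ x y z → (x ∙ y) ∙ z ≡ (x ∙ z) ∙ y
  right-comm = proj₁ identities

  assoc-under-left : ∀ w x y z → w ∙ (x ∙ (y ∙ z)) ≡ w ∙ ((x ∙ y) ∙ z)
  assoc-under-left = proj₁ (proj₂ identities)

  medial : ∀ w x y z → (w ∙ x) ∙ (y ∙ z) ≡ (w ∙ y) ∙ (x ∙ z)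
  medial = proj₂ (proj₂ identities)

  spine : G → List G → G
  spine = foldl _∙_

  spine-pull : ∀ x z ys → spine (x ∙ z) ys ≡ spine x ys ∙ z
  spine-pull x z [] = refl
  spine-pull x z (y ∷ ys) = trans (cong (λ w → spine w ys) (right-comm x z y)) (spine-pull (x ∙ y) z ys)

  spine-resp-↭ : ∀ {xs ys} → xs ↭ ys → ∀ x → spine x xs ≡ spine x ys
  spine-resp-↭ (_↭_.refl) x = refl
  spine-resp-↭ (prep y p) x = spine-resp-↭ p (x ∙ y)
  spine-resp-↭ (swap {xs = zs} a b p) x =
    trans (cong (λ w → spine w zs) (right-comm x a b)) (spine-resp-↭ p ((x ∙ b) ∙ a))
  spine-resp-↭ (_↭_.trans p q) x = trans (spine-resp-↭ p x) (spine-resp-↭ q x)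

  merge : ∀ q β β' c c' → (q ∙ spine β c) ∙ spine β' c' ≡ (q ∙ spine β (c ++ c')) ∙ β'
  merge q β β' c [] = cong (λ l → (q ∙ spine β l) ∙ β') (sym (++-identityʳ c))
  merge q β β' c (z ∷ c') = begin
    (q ∙ spine β c) ∙ spine (β' ∙ z) c'       ≡⟨ cong ((q ∙ spine β c) ∙_) (spine-pull β' z c') ⟩
    (q ∙ spine β c) ∙ (spine β' c' ∙ z)       ≡⟨ medial q (spine β c) (spine β' c') z ⟩
    (q ∙ spine β' c') ∙ (spine β c ∙ z)       ≡⟨ right-comm q (spine β' c') (spine β c ∙ z) ⟩
    (q ∙ (spine β c ∙ z)) ∙ spine β' c'       ≡⟨ cong (λ w → (q ∙ w) ∙ spine β' c') (sym (foldl-∷ʳ _∙_ β z c)) ⟩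
    (q ∙ spine β (c ∷ʳ z)) ∙ spine β' c'      ≡⟨ merge q β β' (c ∷ʳ z) c' ⟩
    (q ∙ spine β ((c ∷ʳ z) ++ c')) ∙ β'       ≡⟨ cong (λ l → (q ∙ spine β l) ∙ β') (++-assoc c [ z ] c') ⟩
    (q ∙ spine β (c ++ z ∷ c')) ∙ β'          ∎
    where open ≡-Reasoning

  nf : G → List G → List G → G
  nf α [] C = α
  nf α (β ∷ βs) C = spine (α ∙ spine β C) βs

  module Evaluation (ρ : Fin n → G) where

    ⟦_⟧ : Term n → G
    ⟦ t ⟧ = eval _∙_ t ρ

    flatten-argument : ∀ w x u → w ∙ (x ∙ ⟦ u ⟧) ≡ w ∙ spine x (map ρ (leaves u))
    flatten-argument w x (var i) = refl
    flatten-argument w x (u₁ · u₂) = begin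
      w ∙ (x ∙ (⟦ u₁ ⟧ ∙ ⟦ u₂ ⟧))   ≡⟨ assoc-under-left w x ⟦ u₁ ⟧ ⟦ u₂ ⟧ ⟩
      w ∙ ((x ∙ ⟦ u₁ ⟧) ∙ ⟦ u₂ ⟧)   ≡⟨ flatten-argument w (x ∙ ⟦ u₁ ⟧) u₂ ⟩
      w ∙ spine (x ∙ ⟦ u₁ ⟧) L₂      ≡⟨ cong (w ∙_) (spine-pull x ⟦ u₁ ⟧ L₂) ⟩
      w ∙ (spine x L₂ ∙ ⟦ u₁ ⟧)      ≡⟨ flatten-argument w (spine x L₂) u₁ ⟩
      w ∙ spine (spine x L₂) L₁      ≡⟨ cong (w ∙_) (sym (foldl-++ _∙_ x L₂ L₁)) ⟩
      w ∙ spine x (L₂ ++ L₁)         ≡⟨ cong (w ∙_) (spine-resp-↭ (++-comm-↭ L₂ L₁) x) ⟩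
      w ∙ spine x (L₁ ++ L₂)         ≡⟨ cong (λ l → w ∙ spine x l) (sym (map-++ ρ (leaves u₁) (leaves u₂))) ⟩
      w ∙ spine x (map ρ (leaves u₁ ++ leaves u₂)) ∎
      where
        open ≡-Reasoning
        L₁ = map ρ (leaves u₁)
        L₂ = map ρ (leaves u₂)

    unfold-leftmost : ∀ w u rest →
      w ∙ spine ⟦ u ⟧ rest ≡ w ∙ spine (ρ (leftmost u)) (map ρ (tailLeaves u) ++ rest)
    unfold-leftmost w (var i) rest = refl
    unfold-leftmost w (u₁ · u₂) rest = begin
      w ∙ spine (⟦ u₁ ⟧ ∙ ⟦ u₂ ⟧) rest  ≡⟨ cong (w ∙_) (spine-pull ⟦ u₁ ⟧ ⟦ u₂ ⟧ rest) ⟩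
      w ∙ (spine ⟦ u₁ ⟧ rest ∙ ⟦ u₂ ⟧)  ≡⟨ flatten-argument w (spine ⟦ u₁ ⟧ rest) u₂ ⟩
      w ∙ spine (spine ⟦ u₁ ⟧ rest) L₂  ≡⟨ cong (w ∙_) (sym (foldl-++ _∙_ ⟦ u₁ ⟧ rest L₂)) ⟩
      w ∙ spine ⟦ u₁ ⟧ (rest ++ L₂)     ≡⟨ unfold-leftmost w u₁ (rest ++ L₂) ⟩
      w ∙ spine a (T₁ ++ rest ++ L₂)    ≡⟨ cong (w ∙_) (spine-resp-↭ reorder a) ⟩
      w ∙ spine a ((T₁ ++ L₂) ++ rest)  ≡⟨ cong (λ l → w ∙ spine a (l ++ rest)) (map-++ ρ (tailLeaves u₁) (leaves u₂)) ⟨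
      w ∙ spine a (map ρ (tailLeaves u₁ ++ leaves u₂) ++ rest) ∎
      where
        open ≡-Reasoning
        a = ρ (leftmost u₁)
        T₁ = map ρ (tailLeaves u₁)
        L₂ = map ρ (leaves u₂)
        reorder : T₁ ++ rest ++ L₂ ↭ (T₁ ++ L₂) ++ rest
        reorder = ↭-trans (++⁺ˡ T₁ (++-comm-↭ rest L₂)) (↭-reflexive (sym (++-assoc T₁ L₂ rest)))

    absorb-argument : ∀ q β C u →
      (q ∙ spine β C) ∙ ⟦ u ⟧ ≡ (q ∙ spine β (C ++ map ρ (tailLeaves u))) ∙ ρ (leftmost u)
    absorb-argument q β C u = begin
      (q ∙ spine β C) ∙ ⟦ u ⟧  ≡⟨ right-comm q (spine β C) ⟦ u ⟧ ⟩
      (q ∙ ⟦ u ⟧) ∙ spine β C  ≡⟨ cong (_∙ spine β C) (unfold-leftmost q u []) ⟩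
      (q ∙ spine a (T ++ [])) ∙ spine β C  ≡⟨ cong (λ l → (q ∙ spine a l) ∙ spine β C) (++-identityʳ T) ⟩
      (q ∙ spine a T) ∙ spine β C  ≡⟨ right-comm q (spine a T) (spine β C) ⟩
      (q ∙ spine β C) ∙ spine a T  ≡⟨ merge q β a C T ⟩
      (q ∙ spine β (C ++ T)) ∙ a   ∎
      where
        open ≡-Reasoning
        a = ρ (leftmost u)
        T = map ρ (tailLeaves u)

    nf-extend : ∀ α (D C : List (Fin n)) u → (D ≡ [] → C ≡ []) →
      nf α (map ρ D) (map ρ C) ∙ ⟦ u ⟧ ≡ nf α (map ρ (D ++ [ leftmost u ])) (map ρ (C ++ tailLeaves u))
    nf-extend α [] C u noDeep rewrite noDeep refl =
      trans (unfold-leftmost α u [])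
            (cong (λ l → α ∙ spine (ρ (leftmost u)) l) (++-identityʳ (map ρ (tailLeaves u))))
    nf-extend α (b ∷ D) C u _ = begin
      spine (α ∙ spine β C′) D′ ∙ ⟦ u ⟧          ≡⟨ sym (spine-pull (α ∙ spine β C′) ⟦ u ⟧ D′) ⟩
      spine ((α ∙ spine β C′) ∙ ⟦ u ⟧) D′        ≡⟨ cong (λ w → spine w D′) (absorb-argument α β C′ u) ⟩
      spine ((α ∙ spine β (C′ ++ T)) ∙ a) D′     ≡⟨ spine-resp-↭ (∷↭∷ʳ a D′) (α ∙ spine β (C′ ++ T)) ⟩
      spine (α ∙ spine β (C′ ++ T)) (D′ ∷ʳ a)    ≡⟨ cong₂ (λ l m → spine (α ∙ spine β l) m)
                                                        (map-++ ρ C (tailLeaves u)) (map-++ ρ D [ leftmost u ]) ⟨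
      spine (α ∙ spine β (map ρ (C ++ tailLeaves u))) (map ρ (D ++ [ leftmost u ])) ∎
      where
        open ≡-Reasoning
        β = ρ b
        a = ρ (leftmost u)
        C′ = map ρ C
        D′ = map ρ D
        T = map ρ (tailLeaves u)

    normal-form : ∀ t → ⟦ t ⟧ ≡ nf (ρ (leftmost t)) (map ρ (depth1 t)) (map ρ (depth≥2 t))
    normal-form (var i) = refl
    normal-form (t · u) = begin
      ⟦ t ⟧ ∙ ⟦ u ⟧
        ≡⟨ cong (_∙ ⟦ u ⟧) (normal-form t) ⟩
      nf α (map ρ (depth1 t)) (map ρ (depth≥2 t)) ∙ ⟦ u ⟧
        ≡⟨ nf-extend α (depth1 t) (depth≥2 t) u (depth≥2-empty (arguments t)) ⟩
      nf α (map ρ (depth1 t ++ [ leftmost u ])) (map ρ (depth≥2 t ++ tailLeaves u))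
        ≡⟨ cong₂ (λ D C → nf α (map ρ D) (map ρ C)) (sym (depth1-· t u)) (sym (depth≥2-· t u)) ⟩
      nf α (map ρ (depth1 (t · u))) (map ρ (depth≥2 (t · u))) ∎
      where
        open ≡-Reasoning
        α = ρ (leftmost t)

  nf-swap : ∀ α β γ δs C → nf α (β ∷ γ ∷ δs) C ≡ nf α (γ ∷ β ∷ δs) C
  nf-swap α β γ δs C =
    cong (λ w → spine w δs) (trans (sym (merge α β γ [] C)) (right-comm α β (spine γ C)))

  nf-resp-↭ˡ : ∀ α β βs γ γs C → β ∷ βs ↭ γ ∷ γs → nf α (β ∷ βs) C ≡ nf α (γ ∷ γs) C
  nf-resp-↭ˡ α β βs γ γs C p with ∈-resp-↭ p (here refl)
  ... | here refl = spine-resp-↭ (drop-∷ p) (α ∙ spine β C)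
  ... | there γ∈γs with ∈-∃++ γ∈γs
  ... | l , r , refl = begin
    nf α (β ∷ βs) C               ≡⟨ spine-resp-↭ (drop-∷ p′) (α ∙ spine β C) ⟩
    nf α (β ∷ γ ∷ l ++ r) C       ≡⟨ nf-swap α β γ (l ++ r) C ⟩
    nf α (γ ∷ β ∷ l ++ r) C       ≡⟨ spine-resp-↭ (↭-sym (shift β l r)) (α ∙ spine γ C) ⟩
    nf α (γ ∷ l ++ [ β ] ++ r) C  ∎
    where
      open ≡-Reasoning
      p′ : β ∷ βs ↭ β ∷ γ ∷ l ++ r
      p′ = ↭-trans p (↭-trans (prep γ (shift β l r)) (swap γ β ↭-refl))

  nf-resp-↭ : ∀ α {D D′ C C′} → D ↭ D′ → C ↭ C′ → nf α D C ≡ nf α D′ C′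
  nf-resp-↭ α {[]} {D′} p q rewrite ↭-empty-inv (↭-sym p) = refl
  nf-resp-↭ α {β ∷ D} {[]} p q with () ← ↭-empty-inv p
  nf-resp-↭ α {β ∷ D} {γ ∷ D′} {C} {C′} p q =
    trans (cong (λ w → spine (α ∙ w) D) (spine-resp-↭ q β)) (nf-resp-↭ˡ α β D γ D′ C′ p)

  sameDepths⇒sameOp : ∀ {t u : Term n} → SameDepths t u → SameOp _∙_ t u
  sameDepths⇒sameOp {t = t} {u} (sameDepths ≡lm ↭d1 ↭d2) ρ = begin
    ⟦ t ⟧                                                     ≡⟨ normal-form t ⟩
    nf (ρ (leftmost t)) (map ρ (depth1 t)) (map ρ (depth≥2 t))
      ≡⟨ cong (λ a → nf (ρ a) (map ρ (depth1 t)) (map ρ (depth≥2 t))) ≡lm ⟩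
    nf (ρ (leftmost u)) (map ρ (depth1 t)) (map ρ (depth≥2 t)) ≡⟨ nf-resp-↭ _ (map⁺ ρ ↭d1) (map⁺ ρ ↭d2) ⟩
    nf (ρ (leftmost u)) (map ρ (depth1 u)) (map ρ (depth≥2 u)) ≡⟨ normal-form u ⟨
    ⟦ u ⟧                                                     ∎
    where
      open ≡-Reasoning
      open Evaluation ρ

record Shape (n : ℕ) : Set where
  constructor shape
  field
    root : Fin n
    shallow : List⁺ (Fin n)
    deep : List (Fin n)

open Shape

variables : Shape n → List (Fin n)
variables sh = root sh ∷ toList (shallow sh) ++ deep sh

representative : Shape n → Term n
representative (shape a (b ∷⁺ bs) c) = applyAll (var a · applyAll (var b) (map var c)) (map var bs)

leftmost-vars : (xs : List (Fin n)) → map leftmost (map var xs) ≡ xs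
leftmost-vars [] = refl
leftmost-vars (x ∷ xs) = cong (x ∷_) (leftmost-vars xs)

concatMap-leaves-vars : (xs : List (Fin n)) → concatMap leaves (map var xs) ≡ xs
concatMap-leaves-vars [] = refl
concatMap-leaves-vars (x ∷ xs) = cong (x ∷_) (concatMap-leaves-vars xs)

concatMap-tailLeaves-vars : (xs : List (Fin n)) → concatMap tailLeaves (map var xs) ≡ []
concatMap-tailLeaves-vars [] = refl
concatMap-tailLeaves-vars (x ∷ xs) = concatMap-tailLeaves-vars xs

leftmost-representative : (sh : Shape n) → leftmost (representative sh) ≡ root sh
leftmost-representative (shape a (b ∷⁺ bs) c) =
  leftmost-applyAll (var a · applyAll (var b) (map var c)) (map var bs)

depth1-representative : (sh : Shape n) → depth1 (representative sh) ≡ toList (shallow sh)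
depth1-representative (shape a (b ∷⁺ bs) c)
  rewrite arguments-applyAll (var a · applyAll (var b) (map var c)) (map var bs)
        | leftmost-applyAll (var b) (map var c) = cong (b ∷_) (leftmost-vars bs)

depth≥2-representative : (sh : Shape n) → depth≥2 (representative sh) ≡ deep sh
depth≥2-representative (shape a (b ∷⁺ bs) c)
  rewrite arguments-applyAll (var a · applyAll (var b) (map var c)) (map var bs)
        | tailLeaves-applyAll (var b) (map var c)
        | concatMap-leaves-vars c
        | concatMap-tailLeaves-vars bs = ++-identityʳ c

leaves-representative : (sh : Shape n) → leaves (representative sh) ↭ variables sh
leaves-representative sh with leaves-↭-depths (representative sh)
... | p rewrite leftmost-representative sh | depth1-representative sh | depth≥2-representative sh = p

shapesRootedAt : Fin n → List (Fin n) → List (Shape n)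
shapesRootedAt a r = map (λ (s , c) → shape a s c) (bipartitions⁺ r)

length-allFin : ∀ n → length (allFin n) ≡ n
length-allFin n = length-tabulate id

shapes : List (Fin n) → List (Shape n)
shapes xs = concatMap (λ (a , r) → shapesRootedAt a r) (selections xs)

shapes-↭ : (xs : List (Fin n)) → All (λ sh → variables sh ↭ xs) (shapes xs)
shapes-↭ xs = All.concat⁺ (All.map⁺ (All.map
  (λ {(a , r)} a∷r↭xs → All.map⁺ (All.map (λ p → ↭-trans (prep a p) a∷r↭xs) (bipartitions⁺-↭ r)))
  (selections-↭ xs)))

length-shapes : ∀ n → length (shapes (allFin n)) ≡ n * (2 ^ (n ∸ 1) ∸ 1)
length-shapes n = begin
  length (shapes (allFin n))
    ≡⟨ length-concatMap _ (2 ^ (n ∸ 1) ∸ 1) (All.map length-block (selections-↭ (allFin n))) ⟩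
  length (selections (allFin n)) * (2 ^ (n ∸ 1) ∸ 1)
    ≡⟨ cong (_* (2 ^ (n ∸ 1) ∸ 1)) (trans (length-selections (allFin n)) (length-allFin n)) ⟩
  n * (2 ^ (n ∸ 1) ∸ 1) ∎
  where
    open ≡-Reasoning
    length-block : ∀ {(a , r) : Fin n × List (Fin n)} → a ∷ r ↭ allFin n →
      length (shapesRootedAt a r) ≡ 2 ^ (n ∸ 1) ∸ 1
    length-block {a , r} a∷r↭ = begin
      length (shapesRootedAt a r)  ≡⟨ length-map _ (bipartitions⁺ r) ⟩
      length (bipartitions⁺ r)     ≡⟨ cong (_∸ 1) (suc-length-bipartitions⁺ r) ⟩
      2 ^ length r ∸ 1             ≡⟨ cong (λ k → 2 ^ (k ∸ 1) ∸ 1) (trans (↭-length a∷r↭) (length-allFin n)) ⟩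
      2 ^ (n ∸ 1) ∸ 1              ∎

shapes-cover : ∀ (xs : List (Fin n)) a b bs c → a ∷ (b ∷ bs) ++ c ↭ xs →
  ∃ λ sh → sh ∈ shapes xs × root sh ≡ a × toList (shallow sh) ↭ b ∷ bs × deep sh ↭ c
shapes-cover xs a b bs c p
  with r , ar∈ , r↭ ← selections-cover xs p
  with s′ , c′ , sc∈ , s′↭ , c′↭ ← bipartitions⁺-cover r b bs c (↭-sym r↭) =
  shape a s′ c′ , ∈-concatMap⁺ _ (Any.map (λ { refl → ∈-map⁺ _ sc∈ }) ar∈) , refl , s′↭ , c′↭

ShapeSeparated : Shape n → Shape n → Set
ShapeSeparated sh sh′ =
  root sh ≢ root sh′ ⊎ Separated (toList (shallow sh) , deep sh) (toList (shallow sh′) , deep sh′)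

shapes-separated : {xs : List (Fin n)} → Unique xs → AllPairs ShapeSeparated (shapes xs)
shapes-separated {xs = xs} u = AllPairs.concat⁺
  (All.map⁺ (All.universal (λ (a , r) → AllPairs.map⁺ (AllPairs.map inj₂ (bipartitions⁺-separated r)))
                           (selections xs)))
  (AllPairs.map⁺ (AllPairs.map (λ {(a , r)} {(a′ , r′)} a≢a′ →
     All-All-map _ _ (λ _ _ → inj₁ a≢a′) (bipartitions⁺ r) (bipartitions⁺ r′)) (selections-distinct u)))

depth1-nonempty : 2 ≤ n → (t : Term n) → IsFullLinear t → ∃₂ λ b bs → depth1 t ≡ b ∷ bs
depth1-nonempty {n} 2≤n t lin with arguments t | leaves-arguments t
... | [] | eq = ⊥-elim (2≰1 2≤n (trans (sym (length-allFin n)) (sym (↭-length (subst (_↭ allFin n) eq lin)))))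
  where
    2≰1 : ∀ {k} → 2 ≤ k → k ≡ 1 → ⊥
    2≰1 (s≤s (s≤s _)) ()
... | u ∷ us | _ = leftmost u , map leftmost us , refl

linearRepresentatives : ∀ n → List (Term n)
linearRepresentatives n = map representative (shapes (allFin n))

linearRepresentatives-linear : ∀ n → All IsFullLinear (linearRepresentatives n)
linearRepresentatives-linear n =
  All.map⁺ (All.map (λ {sh} p → ↭-trans (leaves-representative sh) p) (shapes-↭ (allFin n)))

length-linearRepresentatives : ∀ n → length (linearRepresentatives n) ≡ n * (2 ^ (n ∸ 1) ∸ 1)
length-linearRepresentatives n = trans (length-map representative (shapes (allFin n))) (length-shapes n)

linearRepresentatives-cover : 2 ≤ n → (t : Term n) → IsFullLinear t →
  ∃ λ r → r ∈ linearRepresentatives n × SameDepths r t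
linearRepresentatives-cover {n} 2≤n t lin
  with b , bs , d1≡ ← depth1-nonempty 2≤n t lin
  with sh , sh∈ , root≡ , s↭ , c↭ ←
       shapes-cover (allFin n) (leftmost t) b bs (depth≥2 t)
         (subst (λ d → leftmost t ∷ d ++ depth≥2 t ↭ allFin n) d1≡ (↭-trans (↭-sym (leaves-↭-depths t)) lin)) =
  representative sh , ∈-map⁺ representative sh∈ , sameDepths
    (trans (leftmost-representative sh) root≡)
    (subst₂ _↭_ (sym (depth1-representative sh)) (sym d1≡) s↭)
    (subst (_↭ depth≥2 t) (sym (depth≥2-representative sh)) c↭)

Unique-depths : (t : Term n) → IsFullLinear t → Unique (depth1 t ++ depth≥2 t)
Unique-depths {n} t lin with Unique-resp-↭ (↭-trans (↭-sym lin) (leaves-↭-depths t)) (allFin⁺ n)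
... | _ ∷ u = u

-- The argument lists of the bracketings of the word  t y₁ ⋯ yₖ  into left-combed blocks:
-- each yᵢ either starts a new argument or extends the current one.
blockings : Term n → List (Fin n) → List (List (Term n))
blockings t [] = [ [ t ] ]
blockings t (y ∷ ys) = map (t ∷_) (blockings (var y) ys) ++ blockings (t · var y) ys

length-blockings : (t : Term n) (ys : List (Fin n)) → length (blockings t ys) ≡ 2 ^ length ys
length-blockings t [] = refl
length-blockings t (y ∷ ys) = begin
  length (map (t ∷_) (blockings (var y) ys) ++ blockings (t · var y) ys)
    ≡⟨ length-++ (map (t ∷_) (blockings (var y) ys)) ⟩
  length (map (t ∷_) (blockings (var y) ys)) + length (blockings (t · var y) ys)
    ≡⟨ cong₂ _+_ (trans (length-map _ (blockings (var y) ys)) (length-blockings (var y) ys))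
                 (trans (length-blockings (t · var y) ys) (sym (+-identityʳ (2 ^ length ys)))) ⟩
  2 ^ length ys + (2 ^ length ys + 0) ∎
  where open ≡-Reasoning

blockings-leaves : (t : Term n) (ys : List (Fin n)) →
  All (λ us → concatMap leaves us ≡ leaves t ++ ys) (blockings t ys)
blockings-leaves t [] = refl ∷ []
blockings-leaves t (y ∷ ys) = All.++⁺
  (All.map⁺ (All.map (cong (leaves t ++_)) (blockings-leaves (var y) ys)))
  (All.map (λ eq → trans eq (++-assoc (leaves t) [ y ] ys)) (blockings-leaves (t · var y) ys))

blockings-leftmost : (t : Term n) (ys : List (Fin n)) → All (λ us → leftmost t ∈ map leftmost us) (blockings t ys)
blockings-leftmost t [] = here refl ∷ []
blockings-leftmost t (y ∷ ys) =
  All.++⁺ (All.map⁺ (All.universal (λ _ → here refl) (blockings (var y) ys))) (blockings-leftmost (t · var y) ys)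

blockings-tailLeaves : (t : Term n) (ys : List (Fin n)) →
  All (λ us → tailLeaves t ⊆ concatMap tailLeaves us) (blockings t ys)
blockings-tailLeaves t [] = (λ z∈ → ∈-++⁺ˡ z∈) ∷ []
blockings-tailLeaves t (y ∷ ys) = All.++⁺
  (All.map⁺ {f = t ∷_} (All.universal (λ _ {_} → ∈-++⁺ˡ) (blockings (var y) ys)))
  (All.map (λ ⊆us {_} z∈ → ⊆us (∈-++⁺ˡ z∈)) (blockings-tailLeaves (t · var y) ys))

depthsOf : List (Term n) → List (Fin n) × List (Fin n)
depthsOf us = map leftmost us , concatMap tailLeaves us

blockings-separated : (t : Term n) (ys : List (Fin n)) → AllPairs (Separated on depthsOf) (blockings t ys)
blockings-separated t [] = [] ∷ []
blockings-separated t (y ∷ ys) = AllPairs.++⁺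
  (AllPairs.map⁺ (AllPairs.map extend (blockings-separated (var y) ys)))
  (blockings-separated (t · var y) ys)
  (All.map⁺ (All.map
    (λ y∈us → All.map (λ ⊆us′ → inj₁ (y , there y∈us , ⊆us′ (∈-++⁺ʳ (tailLeaves t) (here refl))))
                      (blockings-tailLeaves (t · var y) ys))
    (blockings-leftmost (var y) ys)))
  where
    extend : ∀ {us us′} → Separated (depthsOf us) (depthsOf us′) →
      Separated (depthsOf (t ∷ us)) (depthsOf (t ∷ us′))
    extend (inj₁ (z , z∈ , z∈′)) = inj₁ (z , there z∈ , ∈-++⁺ʳ (tailLeaves t) z∈′)
    extend (inj₂ (z , z∈′ , z∈)) = inj₂ (z , there z∈′ , ∈-++⁺ʳ (tailLeaves t) z∈)

blockings-cover : ∀ (t : Term n) ys pre us → pre ++ concatMap leaves us ≡ ys →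
  ∃ λ vs → vs ∈ blockings t ys × map leftmost vs ≡ leftmost t ∷ map leftmost us
blockings-cover t [] [] [] eq = [ t ] , here refl , refl
blockings-cover t [] [] (u ∷ us) eq with () ← trans (cong (_++ concatMap leaves us) (sym (leaves-leftmost u))) eq
blockings-cover t (z ∷ zs) (p ∷ pre) us eq
  with vs , vs∈ , eq′ ← blockings-cover (t · var z) zs pre us (∷-injectiveʳ eq) =
  vs , ∈-++⁺ʳ _ vs∈ , eq′
blockings-cover t (z ∷ zs) [] (u ∷ us) eq
  with eq₁ ← trans (cong (_++ concatMap leaves us) (sym (leaves-leftmost u))) eq
  with vs , vs∈ , eq′ ← blockings-cover (var z) zs (tailLeaves u) us (∷-injectiveʳ eq₁) =
  t ∷ vs , ∈-++⁺ˡ (∈-map⁺ _ vs∈) ,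
  cong (leftmost t ∷_) (trans eq′ (cong (_∷ map leftmost us) (sym (∷-injectiveˡ eq₁))))

laterVars : ∀ m → List (Fin (2 + m))
laterVars m = tabulate (λ i → suc (suc i))

length-laterVars : ∀ m → length (laterVars m) ≡ m
length-laterVars m = length-tabulate _

bracketRepresentatives : ∀ m → List (Term (2 + m))
bracketRepresentatives m = map (applyAll (var zero)) (blockings (var (suc zero)) (laterVars m))

length-bracketRepresentatives : ∀ m → length (bracketRepresentatives m) ≡ 2 ^ m
length-bracketRepresentatives m =
  trans (length-map _ (blockings (var (suc zero)) (laterVars m)))
        (trans (length-blockings _ (laterVars m)) (cong (2 ^_) (length-laterVars m)))

bracketRepresentatives-bracketing : ∀ m → All IsBracketing (bracketRepresentatives m)
bracketRepresentatives-bracketing m = All.map⁺ (All.map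
  (λ {us} eq → trans (leaves-applyAll (var zero) us) (cong (zero ∷_) eq))
  (blockings-leaves (var (suc zero)) (laterVars m)))

depth1-applyAll-var : ∀ (a : Fin n) us → depth1 (applyAll (var a) us) ≡ map leftmost us
depth1-applyAll-var a us = cong (map leftmost) (arguments-applyAll (var a) us)

depth≥2-applyAll-var : ∀ (a : Fin n) us → depth≥2 (applyAll (var a) us) ≡ concatMap tailLeaves us
depth≥2-applyAll-var a us = cong (concatMap tailLeaves) (arguments-applyAll (var a) us)

DepthSeparated : Term n → Term n → Set
DepthSeparated t u = Separated (depth1 t , depth≥2 t) (depth1 u , depth≥2 u)

bracketRepresentatives-separated : ∀ m → AllPairs DepthSeparated (bracketRepresentatives m)
bracketRepresentatives-separated m = AllPairs.map⁺ (AllPairs.map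
  (λ {us} {us′} → subst₂ Separated
     (sym (cong₂ _,_ (depth1-applyAll-var zero us) (depth≥2-applyAll-var zero us)))
     (sym (cong₂ _,_ (depth1-applyAll-var zero us′) (depth≥2-applyAll-var zero us′))))
  (blockings-separated (var (suc zero)) (laterVars m)))

depth≥2-determined : ∀ (t u : Term n) → leaves t ↭ leaves u → leftmost t ≡ leftmost u →
  depth1 t ≡ depth1 u → depth≥2 t ↭ depth≥2 u
depth≥2-determined t u p lm≡ d1≡ = ++-cancelˡ-↭ (leftmost u ∷ depth1 u)
  (subst₂ (λ a d → a ∷ d ++ depth≥2 t ↭ leftmost u ∷ depth1 u ++ depth≥2 u) lm≡ d1≡
    (↭-trans (↭-sym (leaves-↭-depths t)) (↭-trans p (leaves-↭-depths u))))

sameDepths-of-bracketings : ∀ (r t : Term n) → IsBracketing r → IsBracketing t →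
  leftmost r ≡ leftmost t → depth1 r ≡ depth1 t → SameDepths r t
sameDepths-of-bracketings r t br bt lm≡ d1≡ =
  sameDepths lm≡ (↭-reflexive d1≡) (depth≥2-determined r t (↭-reflexive (trans br (sym bt))) lm≡ d1≡)

bracketRepresentatives-cover : ∀ m (t : Term (2 + m)) → IsBracketing t →
  ∃ λ r → r ∈ bracketRepresentatives m × SameDepths r t
bracketRepresentatives-cover m t bt = cover (arguments t) refl
  where
    leaves≡ : ∀ {us} → arguments t ≡ us → leftmost t ∷ concatMap leaves us ≡ allFin (2 + m)
    leaves≡ refl = trans (sym (leaves-arguments t)) bt
    cover : ∀ us → arguments t ≡ us → ∃ λ r → r ∈ bracketRepresentatives m × SameDepths r t
    cover [] args≡ with () ← ∷-injectiveʳ (leaves≡ args≡)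
    cover (u ∷ us) args≡
      with eq ← trans (cong (_++ concatMap leaves us) (sym (leaves-leftmost u))) (∷-injectiveʳ (leaves≡ args≡))
      with vs , vs∈ , vs≡ ← blockings-cover (var (suc zero)) (laterVars m) (tailLeaves u) us (∷-injectiveʳ eq) =
      applyAll (var zero) vs , ∈-map⁺ _ vs∈ ,
      sameDepths-of-bracketings (applyAll (var zero) vs) t
        (All.lookup (bracketRepresentatives-bracketing m) (∈-map⁺ _ vs∈)) bt
        (trans (leftmost-applyAll (var zero) vs) (sym (∷-injectiveˡ (leaves≡ args≡))))
        (trans (depth1-applyAll-var zero vs)
          (trans vs≡ (trans (cong (_∷ map leftmost us) (sym (∷-injectiveˡ eq)))
                            (cong (map leftmost) (sym args≡)))))

separated-depth1-≭ : ∀ {t u : Term n} → IsFullLinear t → IsFullLinear u →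
  DepthSeparated t u → ¬ (depth1 t ↭ depth1 u)
separated-depth1-≭ {t = t} {u} lin-t lin-u (inj₁ (z , z∈t , z∈u)) d1↭ =
  Unique-++⇒disjoint (depth1 u) (Unique-depths u lin-u) (∈-resp-↭ d1↭ z∈t) z∈u
separated-depth1-≭ {t = t} {u} lin-t lin-u (inj₂ (z , z∈u , z∈t)) d1↭ =
  Unique-++⇒disjoint (depth1 t) (Unique-depths t lin-t) (∈-resp-↭ (↭-sym d1↭) z∈u) z∈t

-- f misses p, so punching p out of its values gives a map Fin (suc k) → Fin k, which has a collision.
injective⇒surjective : ∀ {k} (f : Fin k → Fin k) → (∀ {i j} → f i ≡ f j → i ≡ j) → ∀ p → ∃ λ i → f i ≡ p
injective⇒surjective {suc k} f f-inj p with any? (λ i → f i ≟ p)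
... | yes hit = hit
... | no miss with i , j , i<j , eq ← pigeonhole (n<1+n k) (λ i → punchOut (λ p≡fi → miss (i , sym p≡fi))) =
  ⊥-elim (<⇒≢ i<j (f-inj (punchOut-injective (λ p≡fi → miss (i , sym p≡fi)) (λ p≡fj → miss (j , sym p≡fj)) eq)))

module Counting {G : Set} (_∙_ : G → G → G) {P : Term n → Set} where

  atMost-of-cover : ∀ {k} (L : List (Term n)) → All P L →
    (∀ t → P t → ∃ λ r → r ∈ L × SameOp _∙_ r t) → length L ≤ k → AtMost _∙_ n P k
  atMost-of-cover L P-L cover |L|≤k =
    length L , |L|≤k , lookup L , (λ i → All.lookup P-L (∈-lookup i)) ,
    λ t Pt → let r , r∈L , r~t = cover t Pt in
      Any.index r∈L , subst (λ r → SameOp _∙_ r t) (lookup-index r∈L) r~t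

  atLeast-of-distinct : ∀ {k} (L : List (Term n)) → All P L →
    AllPairs (λ r r′ → ¬ SameOp _∙_ r r′) L → length L ≡ k → AtLeast _∙_ n P k
  atLeast-of-distinct L P-L distinct refl =
    lookup L , (λ i → All.lookup P-L (∈-lookup i)) , lookup-injective (λ t~u ρ → sym (t~u ρ)) distinct

  -- Sending each of the k distinct operations to a member of L inducing it is injective, hence
  -- surjective, so every member of L induces a different one of them.
  cover-injective : (L : List (Term n)) → (∀ t → P t → ∃ λ r → r ∈ L × SameOp _∙_ r t) →
    AtLeast _∙_ n P (length L) → ∀ {r r′} → r ∈ L → r′ ∈ L → SameOp _∙_ r r′ → r ≡ r′
  cover-injective L cover (g , P-g , g-inj) {r} {r′} r∈L r′∈L r~r′ = begin
    r                       ≡⟨ lookup-index r∈L ⟩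
    lookup L (Any.index r∈L) ≡⟨ cong (lookup L) index≡ ⟩
    lookup L (Any.index r′∈L) ≡⟨ lookup-index r′∈L ⟨
    r′                      ∎
    where
      open ≡-Reasoning
      chosen : ∀ i → ∃ λ r → r ∈ L × SameOp _∙_ r (g i)
      chosen i = cover (g i) (P-g i)
      c : Fin (length L) → Fin (length L)
      c i = Any.index (proj₁ (proj₂ (chosen i)))
      c~g : ∀ i → SameOp _∙_ (lookup L (c i)) (g i)
      c~g i = subst (λ r → SameOp _∙_ r (g i)) (lookup-index (proj₁ (proj₂ (chosen i)))) (proj₂ (proj₂ (chosen i)))
      c-injective : ∀ {i j} → c i ≡ c j → i ≡ j
      c-injective {i} {j} ci≡cj = g-inj i j
        (λ ρ → trans (sym (c~g i ρ)) (subst (λ k → SameOp _∙_ (lookup L k) (g j)) (sym ci≡cj) (c~g j) ρ))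
      at : ∀ {s} (s∈L : s ∈ L) → ∃ λ i → SameOp _∙_ (g i) s × c i ≡ Any.index s∈L
      at s∈L with i , ci≡ ← injective⇒surjective c c-injective (Any.index s∈L) =
        i , subst (SameOp _∙_ (g i)) (trans (cong (lookup L) ci≡) (sym (lookup-index s∈L))) (λ ρ → sym (c~g i ρ)) ,
        ci≡
      index≡ : Any.index r∈L ≡ Any.index r′∈L
      index≡ with i , gi~r , ci≡ ← at r∈L | j , gj~r′ , cj≡ ← at r′∈L =
        trans (sym ci≡) (trans (cong c (g-inj i j λ ρ → trans (gi~r ρ) (trans (r~r′ ρ) (sym (gj~r′ ρ))))) cj≡)

module Bounds {G : Set} (_∙_ : G → G → G) (identities : Identities _∙_) where

  open NormalForm _∙_ identities using (sameDepths⇒sameOp)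

  private
    sameOp-cover : ∀ {P : Term n → Set} {L} → (∀ t → P t → ∃ λ r → r ∈ L × SameDepths r t) →
      ∀ t → P t → ∃ λ r → r ∈ L × SameOp _∙_ r t
    sameOp-cover cover t Pt = map₂ (map₂ sameDepths⇒sameOp) (cover t Pt)

  sacLe-bound : 2 ≤ n → sacLe _∙_ n (n * (2 ^ (n ∸ 1) ∸ 1))
  sacLe-bound {n} 2≤n = Counting.atMost-of-cover _∙_
    (linearRepresentatives n) (linearRepresentatives-linear n)
    (sameOp-cover (linearRepresentatives-cover 2≤n))
    (≤-reflexive (length-linearRepresentatives n))

  sLe-bound : ∀ m → sLe _∙_ (2 + m) (2 ^ m)
  sLe-bound m = Counting.atMost-of-cover _∙_
    (bracketRepresentatives m) (bracketRepresentatives-bracketing m)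
    (sameOp-cover (bracketRepresentatives-cover m))
    (≤-reflexive (length-bracketRepresentatives m))

  -- When the linear representatives induce pairwise distinct operations, two bracketings inducing
  -- the same operation are covered by the same representative, so their depth-one variables agree.
  sGe-of-sacGe : ∀ m → sacGe _∙_ (2 + m) ((2 + m) * (2 ^ (1 + m) ∸ 1)) → sGe _∙_ (2 + m) (2 ^ m)
  sGe-of-sacGe m ge = Counting.atLeast-of-distinct _∙_
    (bracketRepresentatives m) (bracketRepresentatives-bracketing m)
    (AllPairs-mapWith (λ {b} {b′} → distinct {b} {b′})
      (bracketRepresentatives-bracketing m) (bracketRepresentatives-separated m))
    (length-bracketRepresentatives m)
    where
      L = linearRepresentatives (2 + m)
      2≤2+m : 2 ≤ 2 + m
      2≤2+m = s≤s (s≤s z≤n)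
      same-depth1 : ∀ {b b′} → IsBracketing b → IsBracketing b′ → SameOp _∙_ b b′ → depth1 b ↭ depth1 b′
      same-depth1 {b} {b′} br br′ b~b′ =
        let r , r∈ , r≈b = linearRepresentatives-cover 2≤2+m b (↭-reflexive br)
            r′ , r′∈ , r′≈b′ = linearRepresentatives-cover 2≤2+m b′ (↭-reflexive br′)
            r≡r′ = Counting.cover-injective _∙_ L
                     (sameOp-cover (linearRepresentatives-cover 2≤2+m))
                     (subst (AtLeast _∙_ (2 + m) IsFullLinear) (sym (length-linearRepresentatives (2 + m))) ge)
                     r∈ r′∈
                     (λ ρ → trans (sameDepths⇒sameOp r≈b ρ)
                              (trans (b~b′ ρ) (sym (sameDepths⇒sameOp r′≈b′ ρ))))
        in ↭-trans (↭-sym (SameDepths.depth1↭ r≈b))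
                   (subst (λ x → depth1 x ↭ depth1 b′) (sym r≡r′) (SameDepths.depth1↭ r′≈b′))
      distinct : ∀ {b b′} → IsBracketing b → IsBracketing b′ → DepthSeparated b b′ → ¬ SameOp _∙_ b b′
      distinct {b} {b′} br br′ sep b~b′ =
        separated-depth1-≭ {t = b} {b′} (↭-reflexive br) (↭-reflexive br′) sep (same-depth1 {b} {b′} br br′ b~b′)

AttainsBounds : {G : Set} → (G → G → G) → Set
AttainsBounds _∙_ = ∀ n → 2 ≤ n → sEq _∙_ n (2 ^ (n ∸ 2)) × sacEq _∙_ n (n * (2 ^ (n ∸ 1) ∸ 1))

record SeparatingPair {G : Set} (_∙_ : G → G → G) (α β : G) : Set where
  field
    right-neutral : ∀ x y → y ≢ β → x ∙ y ≡ x
    β-left-zero : ∀ y → β ∙ y ≡ β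
    β-left-only : ∀ x y → x ∙ y ≡ β → x ≡ β
    αβ≢α : α ∙ β ≢ α

module Separation {G : Set} (_∙_ : G → G → G) (identities : Identities _∙_)
                  {α β : G} (separating : SeparatingPair _∙_ α β) where

  open SeparatingPair separating
  open NormalForm _∙_ identities using (spine; spine-resp-↭)

  α≢β : α ≢ β
  α≢β α≡β = αβ≢α (trans (cong (_∙ β) α≡β) (trans (β-left-zero β) (sym α≡β)))

  αβ≢β : α ∙ β ≢ β
  αβ≢β = α≢β ∘ β-left-only α β

  spine-β : ∀ ys → spine β ys ≡ β
  spine-β [] = refl
  spine-β (y ∷ ys) rewrite β-left-zero y = spine-β ys

  spine≡β : ∀ x ys → spine x ys ≡ β → x ≡ β
  spine≡β x [] eq = eq
  spine≡β x (y ∷ ys) eq = β-left-only x y (spine≡β (x ∙ y) ys eq)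

  spine-right-neutral : ∀ x ys → All (_≢ β) ys → spine x ys ≡ x
  spine-right-neutral x [] [] = refl
  spine-right-neutral x (y ∷ ys) (y≢β ∷ ys≢β) rewrite right-neutral x y y≢β = spine-right-neutral x ys ys≢β

  indicator : Fin n → Fin n → G
  indicator z x with x ≟ z
  ... | yes _ = β
  ... | no _ = α

  indicator-self : (z : Fin n) → indicator z z ≡ β
  indicator-self z with z ≟ z
  ... | yes _ = refl
  ... | no z≢z = ⊥-elim (z≢z refl)

  indicator-other : {x z : Fin n} → x ≢ z → indicator z x ≡ α
  indicator-other {x = x} {z} x≢z with x ≟ z
  ... | yes x≡z = ⊥-elim (x≢z x≡z)
  ... | no _ = refl

  indicator-others : ∀ {z : Fin n} {ys} → All (_≢ z) ys → All (_≢ β) (map (indicator z) ys)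
  indicator-others ys≢z = All.map⁺ (All.map (λ y≢z → subst (_≢ β) (sym (indicator-other y≢z)) α≢β) ys≢z)

  value : Shape n → Fin n → G
  value sh z = eval _∙_ (representative sh) (indicator z)

  -- The deep variables do not matter: the argument they sit in evaluates to β or to a right-neutral element.
  value-spine : ∀ z (a b : Fin n) bs c →
    value (shape a (b ∷⁺ bs) c) z ≡ spine (indicator z a) (map (indicator z) (b ∷ bs))
  value-spine z a b bs c = begin
    value (shape a (b ∷⁺ bs) c) z
      ≡⟨ eval-applyAll _∙_ (var a · applyAll (var b) (map var c)) (map var bs) ρ ⟩
    spine (ρ a ∙ eval _∙_ (applyAll (var b) (map var c)) ρ) (map (λ u → eval _∙_ u ρ) (map var bs))
      ≡⟨ cong₂ spine (cong (ρ a ∙_) (eval-applyAll _∙_ (var b) (map var c) ρ)) (sym (map-∘ bs)) ⟩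
    spine (ρ a ∙ spine (ρ b) (map (λ u → eval _∙_ u ρ) (map var c))) (map ρ bs)
      ≡⟨ cong (λ x → spine (ρ a ∙ spine (ρ b) x) (map ρ bs)) (sym (map-∘ c)) ⟩
    spine (ρ a ∙ spine (ρ b) (map ρ c)) (map ρ bs)
      ≡⟨ cong (λ x → spine x (map ρ bs)) absorb ⟩
    spine (ρ a ∙ ρ b) (map ρ bs) ∎
    where
      open ≡-Reasoning
      ρ = indicator z
      absorb : ρ a ∙ spine (ρ b) (map ρ c) ≡ ρ a ∙ ρ b
      absorb with b ≟ z
      ... | yes _ = cong (ρ a ∙_) (spine-β (map ρ c))
      ... | no _ = trans (right-neutral (ρ a) _ (α≢β ∘ spine≡β α (map ρ c))) (sym (right-neutral (ρ a) α α≢β))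

  value-root : (sh : Shape n) → value sh (root sh) ≡ β
  value-root (shape a (b ∷⁺ bs) c) = begin
    value (shape a (b ∷⁺ bs) c) a  ≡⟨ value-spine a a b bs c ⟩
    spine (ρ a) (map ρ (b ∷ bs))   ≡⟨ cong (λ x → spine x (map ρ (b ∷ bs))) (indicator-self a) ⟩
    spine β (map ρ (b ∷ bs))       ≡⟨ spine-β (map ρ (b ∷ bs)) ⟩
    β                              ∎
    where
      open ≡-Reasoning
      ρ = indicator a

  value-shallow : (sh : Shape n) {z : Fin n} → Unique (variables sh) → z ∈ toList (shallow sh) → value sh z ≡ α ∙ β
  value-shallow (shape a (b ∷⁺ bs) c) {z} (a∉ ∷ u) z∈s with s₀ , s↭ ← ∈⇒↭∷ z∈s
    with z∉s₀ ∷ _ ← Unique-resp-↭ s↭ (Unique-++⁻ˡ (b ∷ bs) u) = begin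
    value (shape a (b ∷⁺ bs) c) z    ≡⟨ value-spine z a b bs c ⟩
    spine (ρ a) (map ρ (b ∷ bs))     ≡⟨ cong (λ x → spine x (map ρ (b ∷ bs))) (indicator-other a≢z) ⟩
    spine α (map ρ (b ∷ bs))         ≡⟨ spine-resp-↭ (map⁺ ρ s↭) α ⟩
    spine (α ∙ ρ z) (map ρ s₀)       ≡⟨ cong (λ x → spine (α ∙ x) (map ρ s₀)) (indicator-self z) ⟩
    spine (α ∙ β) (map ρ s₀)         ≡⟨ spine-right-neutral (α ∙ β) (map ρ s₀) (indicator-others (All.map (_∘ sym) z∉s₀)) ⟩
    α ∙ β                            ∎
    where
      open ≡-Reasoning
      ρ = indicator z
      a≢z : a ≢ z
      a≢z = All.lookup a∉ (∈-++⁺ˡ z∈s)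

  value-elsewhere : (sh : Shape n) {z : Fin n} → root sh ≢ z → z ∉ toList (shallow sh) → value sh z ≡ α
  value-elsewhere (shape a (b ∷⁺ bs) c) {z} a≢z z∉s = begin
    value (shape a (b ∷⁺ bs) c) z   ≡⟨ value-spine z a b bs c ⟩
    spine (ρ a) (map ρ (b ∷ bs))    ≡⟨ cong (λ x → spine x (map ρ (b ∷ bs))) (indicator-other a≢z) ⟩
    spine α (map ρ (b ∷ bs))        ≡⟨ spine-right-neutral α (map ρ (b ∷ bs)) (indicator-others b∷bs≢z) ⟩
    α                               ∎
    where
      open ≡-Reasoning
      ρ = indicator z
      b∷bs≢z : All (_≢ z) (b ∷ bs)
      b∷bs≢z = All.map (_∘ sym) (All.¬Any⇒All¬ (b ∷ bs) z∉s)

  separated⇒distinct : ∀ {sh sh′ : Shape n} → Unique (variables sh) → Unique (variables sh′) →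
    ShapeSeparated sh sh′ → ¬ SameOp _∙_ (representative sh) (representative sh′)
  separated⇒distinct {sh = sh} {sh′} u u′ (inj₁ root≢) same
    with Any.any? (root sh′ ≟_) (toList (shallow sh))
  ... | yes z∈s = αβ≢β (trans (sym (value-shallow sh u z∈s)) (trans (same _) (value-root sh′)))
  ... | no z∉s = α≢β (trans (sym (value-elsewhere sh root≢ z∉s)) (trans (same _) (value-root sh′)))
  separated⇒distinct {sh = sh} {sh′} u u′@(root∉′ ∷ u′-tail) (inj₂ (inj₁ (z , z∈s , z∈c′))) same =
    αβ≢α (trans (sym (value-shallow sh u z∈s)) (trans (same (indicator z)) (value-elsewhere sh′ root≢z z∉s′)))
    where
      root≢z = All.lookup root∉′ (∈-++⁺ʳ (toList (shallow sh′)) z∈c′)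
      z∉s′ = λ z∈s′ → Unique-++⇒disjoint (toList (shallow sh′)) u′-tail z∈s′ z∈c′
  separated⇒distinct {sh = sh} {sh′} u@(root∉ ∷ u-tail) u′ (inj₂ (inj₂ (z , z∈s′ , z∈c))) same =
    αβ≢α (trans (sym (value-shallow sh′ u′ z∈s′))
                (trans (sym (same (indicator z))) (value-elsewhere sh root≢z z∉s)))
    where
      root≢z = All.lookup root∉ (∈-++⁺ʳ (toList (shallow sh)) z∈c)
      z∉s = λ z∈s → Unique-++⇒disjoint (toList (shallow sh)) u-tail z∈s z∈c

  sacGe-bound : ∀ n → sacGe _∙_ n (n * (2 ^ (n ∸ 1) ∸ 1))
  sacGe-bound n = Counting.atLeast-of-distinct _∙_
    (linearRepresentatives n) (linearRepresentatives-linear n)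
    (AllPairs.map⁺ (AllPairs-mapWith
      (λ {sh} {sh′} p p′ → separated⇒distinct {sh = sh} {sh′} (unique {sh} p) (unique {sh′} p′))
      (shapes-↭ (allFin n)) (shapes-separated (allFin⁺ n))))
    (length-linearRepresentatives n)
    where
      unique : ∀ {sh} → variables sh ↭ allFin n → Unique (variables sh)
      unique p = Unique-resp-↭ (↭-sym p) (allFin⁺ n)

  attainsBounds : AttainsBounds _∙_
  attainsBounds (suc (suc m)) 2≤n@(s≤s (s≤s z≤n)) =
    (sLe-bound m , sGe-of-sacGe m (sacGe-bound _)) , (sacLe-bound 2≤n , sacGe-bound _)
    where open Bounds _∙_ identities

-- Mirror image of a term, with the variables renumbered in reverse so that bracketings stay bracketings.
dual : Term n → Term n
dual (var i) = var (opposite i)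
dual (t · u) = dual u · dual t

dual-involutive : (t : Term n) → dual (dual t) ≡ t
dual-involutive (var i) = cong var (opposite-involutive i)
dual-involutive (t · u) = cong₂ _·_ (dual-involutive t) (dual-involutive u)

eval-dual : ∀ {G : Set} (_∙_ : G → G → G) (t : Term n) ρ → eval _∙_ (dual t) ρ ≡ eval (flip _∙_) t (ρ ∘ opposite)
eval-dual _∙_ (var i) ρ = refl
eval-dual _∙_ (t · u) ρ = cong₂ _∙_ (eval-dual _∙_ u ρ) (eval-dual _∙_ t ρ)

leaves-dual : (t : Term n) → leaves (dual t) ≡ map opposite (reverse (leaves t))
leaves-dual (var i) = refl
leaves-dual (t · u) = begin
  leaves (dual u) ++ leaves (dual t)
    ≡⟨ cong₂ _++_ (leaves-dual u) (leaves-dual t) ⟩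
  map opposite (reverse (leaves u)) ++ map opposite (reverse (leaves t))
    ≡⟨ map-++ opposite (reverse (leaves u)) _ ⟨
  map opposite (reverse (leaves u) ++ reverse (leaves t))
    ≡⟨ cong (map opposite) (reverse-++ (leaves t) (leaves u)) ⟨
  map opposite (reverse (leaves t ++ leaves u)) ∎
  where open ≡-Reasoning

allFin-∷ʳ : ∀ n → allFin (suc n) ≡ map inject₁ (allFin n) ∷ʳ fromℕ n
allFin-∷ʳ zero = refl
allFin-∷ʳ (suc n) = cong (zero ∷_) (begin
  tabulate suc                                      ≡⟨ map-tabulate id suc ⟨
  map suc (allFin (suc n))                          ≡⟨ cong (map suc) (allFin-∷ʳ n) ⟩
  map suc (map inject₁ (allFin n) ∷ʳ fromℕ n)       ≡⟨ map-++ suc (map inject₁ (allFin n)) [ fromℕ n ] ⟩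
  map suc (map inject₁ (allFin n)) ∷ʳ suc (fromℕ n) ≡⟨ cong (_∷ʳ suc (fromℕ n)) (map-∘ (allFin n)) ⟨
  map (suc ∘ inject₁) (allFin n) ∷ʳ suc (fromℕ n)   ≡⟨ cong (_∷ʳ suc (fromℕ n)) (map-∘ (allFin n)) ⟩
  map inject₁ (map suc (allFin n)) ∷ʳ suc (fromℕ n) ≡⟨ cong (λ l → map inject₁ l ∷ʳ suc (fromℕ n)) (map-tabulate id suc) ⟩
  map inject₁ (tabulate suc) ∷ʳ suc (fromℕ n)       ∎)
  where open ≡-Reasoning

reverse-allFin : ∀ n → reverse (allFin n) ≡ map opposite (allFin n)
reverse-allFin zero = refl
reverse-allFin (suc n) = begin
  reverse (allFin (suc n))                           ≡⟨ cong reverse (allFin-∷ʳ n) ⟩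
  reverse (map inject₁ (allFin n) ∷ʳ fromℕ n)        ≡⟨ reverse-++ (map inject₁ (allFin n)) [ fromℕ n ] ⟩
  fromℕ n ∷ reverse (map inject₁ (allFin n))         ≡⟨ cong (fromℕ n ∷_) (reverse-map inject₁ (allFin n)) ⟨
  fromℕ n ∷ map inject₁ (reverse (allFin n))         ≡⟨ cong (λ l → fromℕ n ∷ map inject₁ l) (reverse-allFin n) ⟩
  fromℕ n ∷ map inject₁ (map opposite (allFin n))    ≡⟨ cong (fromℕ n ∷_) (map-∘ (allFin n)) ⟨
  fromℕ n ∷ map (opposite ∘ suc) (allFin n)          ≡⟨ cong (fromℕ n ∷_) (map-∘ (allFin n)) ⟩
  fromℕ n ∷ map opposite (map suc (allFin n))        ≡⟨ cong (λ l → fromℕ n ∷ map opposite l) (map-tabulate id suc) ⟩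
  map opposite (allFin (suc n))                      ∎
  where open ≡-Reasoning

map-opposite-reverse-allFin : ∀ n → map opposite (reverse (allFin n)) ≡ allFin n
map-opposite-reverse-allFin n = begin
  map opposite (reverse (allFin n))        ≡⟨ cong (map opposite) (reverse-allFin n) ⟩
  map opposite (map opposite (allFin n))   ≡⟨ map-∘ (allFin n) ⟨
  map (opposite ∘ opposite) (allFin n)     ≡⟨ map-cong opposite-involutive (allFin n) ⟩
  map id (allFin n)                        ≡⟨ map-id (allFin n) ⟩
  allFin n                                 ∎
  where open ≡-Reasoning

dual-bracketing : (t : Term n) → IsBracketing t → IsBracketing (dual t)
dual-bracketing {n} t br =
  trans (leaves-dual t) (trans (cong (map opposite ∘ reverse) br) (map-opposite-reverse-allFin n))

dual-linear : (t : Term n) → IsFullLinear t → IsFullLinear (dual t)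
dual-linear {n} t lin = ↭-trans (↭-reflexive (leaves-dual t))
  (↭-trans (map⁺ opposite (↭-trans (↭-reverse (leaves t)) (↭-trans lin (↭-sym (↭-reverse (allFin n))))))
           (↭-reflexive (map-opposite-reverse-allFin n)))

module Duality {G : Set} (_∙_ : G → G → G) {P : Term n → Set} (P-dual : ∀ t → P t → P (dual t)) where

  sameOp-dual : ∀ {t u : Term n} → SameOp (flip _∙_) t u → SameOp _∙_ (dual t) (dual u)
  sameOp-dual {t} {u} t~u ρ = trans (eval-dual _∙_ t ρ) (trans (t~u (ρ ∘ opposite)) (sym (eval-dual _∙_ u ρ)))

  sameOp-undual : ∀ {t u : Term n} → SameOp _∙_ (dual t) (dual u) → SameOp (flip _∙_) t u
  sameOp-undual {t} {u} t~u ρ = subst₂ (λ t′ u′ → eval (flip _∙_) t′ ρ ≡ eval (flip _∙_) u′ ρ)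
    (dual-involutive t) (dual-involutive u)
    (trans (eval-dual (flip _∙_) (dual t) ρ) (trans (t~u (ρ ∘ opposite)) (sym (eval-dual (flip _∙_) (dual u) ρ))))

  atMost-dual : ∀ {k} → AtMost (flip _∙_) n P k → AtMost _∙_ n P k
  atMost-dual (k′ , k′≤k , f , P-f , cover) = k′ , k′≤k , dual ∘ f , (λ i → P-dual (f i) (P-f i)) ,
    λ t Pt → let i , fi~t = cover (dual t) (P-dual t Pt) in
      i , subst (SameOp _∙_ (dual (f i))) (dual-involutive t) (sameOp-dual {f i} {dual t} fi~t)

  atLeast-dual : ∀ {k} → AtLeast (flip _∙_) n P k → AtLeast _∙_ n P k
  atLeast-dual (f , P-f , f-inj) =
    dual ∘ f , (λ i → P-dual (f i) (P-f i)) , λ i j → f-inj i j ∘ sameOp-undual {f i} {f j}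

attainsBounds-flip : ∀ {G : Set} (_∙_ : G → G → G) → AttainsBounds (flip _∙_) → AttainsBounds _∙_
attainsBounds-flip _∙_ attains n 2≤n with (sle , sge) , (sacle , sacge) ← attains n 2≤n =
  (B.atMost-dual sle , B.atLeast-dual sge) , (L.atMost-dual sacle , L.atLeast-dual sacge)
  where
    module B = Duality {n = n} _∙_ dual-bracketing
    module L = Duality {n = n} _∙_ dual-linear

identities? : ∀ {k} (_∙_ : Fin k → Fin k → Fin k) → Dec (Identities _∙_)
identities? _∙_ =
  (all? λ x → all? λ y → all? λ z → (x ∙ y) ∙ z ≟ (x ∙ z) ∙ y) ×-dec
  (all? λ w → all? λ x → all? λ y → all? λ z → w ∙ (x ∙ (y ∙ z)) ≟ w ∙ ((x ∙ y) ∙ z)) ×-dec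
  (all? λ w → all? λ x → all? λ y → all? λ z → (w ∙ x) ∙ (y ∙ z) ≟ (w ∙ y) ∙ (x ∙ z))

separatingPair? : ∀ {k} (_∙_ : Fin k → Fin k → Fin k) (α β : Fin k) → Dec (SeparatingPair _∙_ α β)
separatingPair? _∙_ α β = map′
  (λ (rn , lz , lo , ne) → record { right-neutral = rn ; β-left-zero = lz ; β-left-only = lo ; αβ≢α = ne })
  (λ sp → let open SeparatingPair sp in right-neutral , β-left-zero , β-left-only , αβ≢α)
  ((all? λ x → all? λ y → ¬? (y ≟ β) →-dec (x ∙ y ≟ x)) ×-dec
   (all? λ y → β ∙ y ≟ β) ×-dec
   (all? λ x → all? λ y → (x ∙ y ≟ β) →-dec (x ≟ β)) ×-dec
   ¬? (α ∙ β ≟ α))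

SC271-attainsBounds : AttainsBounds SC271
SC271-attainsBounds = Separation.attainsBounds SC271
  (from-yes (identities? SC271)) (from-yes (separatingPair? SC271 𝟙 𝟚))

SC356-attainsBounds : AttainsBounds SC356
SC356-attainsBounds = Separation.attainsBounds SC356
  (from-yes (identities? SC356)) (from-yes (separatingPair? SC356 𝟙 𝟘))

-- SC1610 and SC2032 satisfy the mirrored identities only; their opposite groupoids meet the criterion.
SC1610-attainsBounds : AttainsBounds SC1610
SC1610-attainsBounds = attainsBounds-flip SC1610
  (Separation.attainsBounds (flip SC1610)
    (from-yes (identities? (flip SC1610))) (from-yes (separatingPair? (flip SC1610) 𝟚 𝟘)))

SC2032-attainsBounds : AttainsBounds SC2032
SC2032-attainsBounds = attainsBounds-flip SC2032
  (Separation.attainsBounds (flip SC2032)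
    (from-yes (identities? (flip SC2032))) (from-yes (separatingPair? (flip SC2032) 𝟘 𝟚)))

theorem4p5 :
    (∀ {G : Set} (op : G → G → G) → Identities op → ∀ (n : ℕ) → 2 ≤ n →
       sLe op n (2 ^ (n ∸ 2)) ×
       sacLe op n (n * (2 ^ (n ∸ 1) ∸ 1)) ×
       (sacGe op n (n * (2 ^ (n ∸ 1) ∸ 1)) → sGe op n (2 ^ (n ∸ 2))))
    ×
    All (λ (op : Fin 3 → Fin 3 → Fin 3) → (∀ (n : ℕ) → 2 ≤ n →
           sEq op n (2 ^ (n ∸ 2)) × sacEq op n (n * (2 ^ (n ∸ 1) ∸ 1))))
        (SC271 ∷ SC356 ∷ SC1610 ∷ SC2032 ∷ [])
theorem4p5 = bounds , SC271-attainsBounds ∷ SC356-attainsBounds ∷ SC1610-attainsBounds ∷ SC2032-attainsBounds ∷ []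
  where
    bounds : ∀ {G : Set} (op : G → G → G) → Identities op → ∀ n → 2 ≤ n →
      sLe op n (2 ^ (n ∸ 2)) × sacLe op n (n * (2 ^ (n ∸ 1) ∸ 1)) ×
      (sacGe op n (n * (2 ^ (n ∸ 1) ∸ 1)) → sGe op n (2 ^ (n ∸ 2)))
    bounds op identities (suc (suc m)) 2≤n@(s≤s (s≤s z≤n)) = sLe-bound m , sacLe-bound 2≤n , sGe-of-sacGe m
      where open Bounds op identities
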